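{- Let $V$ be a finite set, $(G_1,\ldots,G_n)$ an $n$-tuple of graphs on vertex set $V$, $A\subseteq V\times[n]$ a color-set, and $m,D>0$ integers. Let $F$ be an oriented edge-colored forest (colors in $[n]$) with at most $mD$ vertices and maximum degree at most $D$, having a leaf $w$ and an edge $v\to w$ of color $\ell$, and let $K=F-w$. Suppose $(G_1,\ldots,G_n)$ is a $(2m,2D+1,A)$-color expander. Then every $(m,D,A)$-good embedding $\varphi$ of $K$ into $(G_1,\ldots,G_n)$ with $(\varphi(v),\ell)\in A$ can be extended to an $(m,D,A)$-good embedding of $F$ into $(G_1,\ldots,G_n)$.
   Context: The edges of $G_i$ are called edges of color $i$. A color-vertex is a pair $(u,i)\in V\times[n]$; a color-set is a subset of $V\times[n]$. For a color-set $S$, $N(S)=\bigcup_{(u,i)\in S}N_{G_i}(u)$. The tuple $(G_1,\ldots,G_n)$ is an $(m,D,A)$-color expander if $|N(S)|\geq D|S|$ for every $S\subseteq A$ with $|S|\leq m$. For an oriented forest $F$ whose edges are colored by $[n]$, an embedding is an injective map $\varphi:V(F)\to V$ such that $\varphi(u)\varphi(u')\in E(G_i)$ whenever $uu'$ is an edge of $F$ of color $i$; $\varphi(F)$ denotes $\varphi(V(F))$. An embedding $\varphi$ is $(m,D,A)$-good if for every $S\subseteq A$ with $|S|\leq m$, $$|N(S)\setminus\varphi(F)|\geq \Big|S\cap\{(\varphi(u),i): u\in V(F)\text{ has an in-edge of color } i\}\Big|+\sum_{(x,i)\in S}\big(D-d_i(x)\big),$$ where $d_i(x)$ is the number of edges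 of color $i$ in $F$ incident to $\varphi^{ -1}(x)$ (and $d_i(x)=0$ if $x\notin\varphi(F)$). An extension of $\varphi$ to $F$ is an embedding $\psi$ of $F$ with $\psi|_{V(K)}=\varphi$. -}

module Defs where

open import Data.Nat as ℕ using (ℕ; zero; suc; _+_; _*_; _≤_)
open import Data.Integer as ℤ using (ℤ; +_)
open import Data.Bool using (Bool; true; false; _∧_; _∨_; not; if_then_else_)
open import Data.Fin using (Fin; zero; suc; toℕ; lower₁; punchOut; _≟_)
open import Data.List using (List; []; _∷_; length; lookup)
open import Data.Product using (_×_; _,_)
open import Data.Sum using (_⊎_)
open import Data.List.Membership.Propositional using (_∈_)
open import Relation.Nullary using (does; ¬_; yes; no)
open import Relation.Binary.PropositionalEquality using (_≡_)
open import Function.Definitions using (Injective)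

sumFin : ∀ {k} → (Fin k → ℕ) → ℕ
sumFin {zero}  f = 0
sumFin {suc k} f = f zero + sumFin (λ j → f (suc j))

sumFinℤ : ∀ {k} → (Fin k → ℤ) → ℤ
sumFinℤ {zero}  f = + 0
sumFinℤ {suc k} f = f zero ℤ.+ sumFinℤ (λ j → f (suc j))

anyFin : ∀ {k} → (Fin k → Bool) → Bool
anyFin {zero}  p = false
anyFin {suc k} p = p zero ∨ anyFin (λ j → p (suc j))

count : ∀ {k} → (Fin k → Bool) → ℕ
count p = sumFin (λ j → if p j then 1 else 0)

countList : ∀ {a} {X : Set a} → (X → Bool) → List X → ℕ
countList p []       = 0
countList p (x ∷ xs) = (if p x then 1 else 0) + countList p xs

anyList : ∀ {a} {X : Set a} → (X → Bool) → List X → Bool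
anyList p []       = false
anyList p (x ∷ xs) = p x ∨ anyList p xs

Graph : ℕ → Set
Graph N = Fin N → Fin N → Bool

IsSimpleGraph : ∀ {N} → Graph N → Set
IsSimpleGraph G = (∀ x y → G x y ≡ G y x) × (∀ x → G x x ≡ false)

ColorSet : ℕ → ℕ → Set
ColorSet N n = Fin N → Fin n → Bool

_⊆ᶜ_ : ∀ {N n} → ColorSet N n → ColorSet N n → Set
S ⊆ᶜ T = ∀ x i → S x i ≡ true → T x i ≡ true

size : ∀ {N n} → ColorSet N n → ℕ
size S = sumFin (λ x → count (S x))

Nbhd : ∀ {N n} → (Fin n → Graph N) → ColorSet N n → Fin N → Bool
Nbhd Gs S y = anyFin (λ u → anyFin (λ i → S u i ∧ Gs i u y))

IsColorExpander : ∀ {N n} → (Fin n → Graph N) → ℕ → ℕ → ColorSet N n → Set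
IsColorExpander Gs m D A =
  ∀ (S : ColorSet _ _) → S ⊆ᶜ A → size S ≤ m → D * size S ≤ count (Nbhd Gs S)

record Edge (k n : ℕ) : Set where
  constructor _⟶_∶_
  field
    src    : Fin k
    tgt    : Fin k
    colour : Fin n
open Edge public

incident : ∀ {k n} → Edge k n → Fin k → Bool
incident e u = does (src e ≟ u) ∨ does (tgt e ≟ u)

degree : ∀ {k n} → List (Edge k n) → Fin k → ℕ
degree E u = countList (λ e → incident e u) E

next : ∀ {r} → Fin (suc r) → Fin (suc r)
next {r} j with r ℕ.≟ toℕ j
... | yes _ = zero
... | no ne = suc (lower₁ j ne)

-- A cycle (in the underlying undirected multigraph) of length r+1:
-- distinct vertices vert 0..r, distinct edges edge 0..r, edge j joins
-- vert j and vert (j+1 mod r+1). (Loops: r = 0; parallel edges: r = 1.)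
record Cycle {k n : ℕ} (E : List (Edge k n)) : Set where
  field
    r        : ℕ
    edge     : Fin (suc r) → Fin (length E)
    vert     : Fin (suc r) → Fin k
    edge-inj : Injective _≡_ _≡_ edge
    vert-inj : Injective _≡_ _≡_ vert
    joins    : ∀ j → let e = lookup E (edge j) in
                 (src e ≡ vert j × tgt e ≡ vert (next j))
                 ⊎ (tgt e ≡ vert j × src e ≡ vert (next j))

IsForest : ∀ {k n} → List (Edge k n) → Set
IsForest E = ¬ Cycle E

removeVertex : ∀ {k n} → Fin (suc k) → List (Edge (suc k) n) → List (Edge k n)
removeVertex w [] = []
removeVertex w (e ∷ E) with w ≟ src e | w ≟ tgt e
... | no p | no q = (punchOut p ⟶ punchOut q ∶ colour e) ∷ removeVertex w E
... | _    | _    = removeVertex w E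

IsEmbedding : ∀ {N n k} → (Fin n → Graph N) → List (Edge k n) → (Fin k → Fin N) → Set
IsEmbedding Gs E φ =
  Injective _≡_ _≡_ φ × (∀ e → e ∈ E → Gs (colour e) (φ (src e)) (φ (tgt e)) ≡ true)

Image : ∀ {N k} → (Fin k → Fin N) → Fin N → Bool
Image φ y = anyFin (λ u → does (φ u ≟ y))

-- d_i(x): number of color-i edges of F incident to φ⁻¹(x) (0 if x ∉ φ(F))
dcol : ∀ {N n k} → List (Edge k n) → (Fin k → Fin N) → Fin n → Fin N → ℕ
dcol E φ i x =
  countList (λ e → does (colour e ≟ i) ∧ (does (φ (src e) ≟ x) ∨ does (φ (tgt e) ≟ x))) E

InSet : ∀ {N n k} → List (Edge k n) → (Fin k → Fin N) → ColorSet N n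
InSet E φ x i = anyList (λ e → does (colour e ≟ i) ∧ does (φ (tgt e) ≟ x)) E

IsGood : ∀ {N n k} → (Fin n → Graph N) → List (Edge k n) → (Fin k → Fin N)
         → ℕ → ℕ → ColorSet N n → Set
IsGood Gs E φ m D A =
  ∀ (S : ColorSet _ _) → S ⊆ᶜ A → size S ≤ m →
    (+ size (λ x i → S x i ∧ InSet E φ x i))
      ℤ.+ sumFinℤ (λ x → sumFinℤ (λ i →
            if S x i then (+ D) ℤ.- (+ dcol E φ i x) else + 0))
    ℤ.≤ + count (λ y → Nbhd Gs S y ∧ not (Image φ y))

GoodEmbedding : ∀ {N n k} → (Fin n → Graph N) → List (Edge k n) → (Fin k → Fin N)
                → ℕ → ℕ → ColorSet N n → Set
GoodEmbedding Gs E φ m D A = IsEmbedding Gs E φ × IsGood Gs E φ m D A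

-- Write the goodness of an embedding φ of K as  Σ_{(x,i) ∈ S} c(x,i) ≤ |N(S) ∖ φ(K)|  with the
-- cost c(x,i) = [x = φ(u) for some u with an in-edge of colour i] + D − dᵢ(x).  Sending the leaf w
-- to an admissible y (a colour-ℓ neighbour of φ(v) outside φ(K)) lowers the cost of (φ(v), ℓ) by
-- one, leaves every other cost unchanged, and removes y from the right-hand side.  So if this
-- extension is not good, some violating set S avoids (φ(v), ℓ), has y ∈ N(S) and is tight for φ.
-- If every admissible y failed, the union U of these tight sets would again be tight, by
-- submodularity of S ↦ |N(S) ∖ φ(K)| and modularity of the cost, and tightness together with the
-- (2m, 2D+1)-expansion forces |U| < m.  Adding (φ(v), ℓ) to U does not enlarge N(U) ∖ φ(K), so the
-- goodness of φ gives c(φ(v), ℓ) ≤ 0; but c(φ(v), ℓ) ≥ 1 since v has degree at most D − 1 in K.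
module Submission where

open import Data.Bool using (Bool; true; false; _∧_; _∨_; not; if_then_else_)
import Data.Bool as Bool
import Data.Bool.Properties as BoolP
open import Data.Empty using (⊥-elim)
open import Data.Fin using (Fin; zero; suc; punchIn; punchOut; _≟_)
import Data.Fin.Properties as FinP
open import Data.Integer as ℤ using (ℤ; +_; -_; +≤+)
import Data.Integer.Properties as ℤP
open import Data.Integer.Tactic.RingSolver using (solve-∀)
open import Data.List using (List; []; _∷_; allFin)
open import Data.List.Membership.Propositional using (_∈_)
open import Data.List.Membership.Propositional.Properties using (∈-allFin)
open import Data.List.Relation.Unary.Any using (here; there; index)
open import Data.List.Relation.Unary.Any.Properties using (lookup-index)
open import Data.Nat as ℕ using (ℕ; zero; suc; _+_; _*_; _≤_; _<_; z≤n; s≤s)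
import Data.Nat.Properties as ℕP
import Data.Nat.Tactic.RingSolver as ℕSolver
open import Data.Product using (∃; _×_; _,_; proj₁; proj₂)
open import Data.Sum using (_⊎_; inj₁; inj₂)
open import Algebra.Bundles using (CommutativeMonoid)
open import Function using (_∘′_)
open import Function.Definitions using (Injective)
open import Relation.Binary.PropositionalEquality
open import Relation.Nullary using (does; ¬_; yes; no; Dec)
open import Relation.Nullary.Decidable using (dec-true; dec-false; _×-dec_; _→-dec_; ¬?)

open import Defs

χ : Bool → ℤ
χ b = if b then + 1 else + 0

χ-nonneg : ∀ b → + 0 ℤ.≤ χ b
χ-nonneg true  = +≤+ z≤n
χ-nonneg false = +≤+ z≤n

χ-≤1 : ∀ b → χ b ℤ.≤ + 1
χ-≤1 true  = ℤP.≤-refl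
χ-≤1 false = +≤+ z≤n

χ-mono : ∀ {a b} → (a ≡ true → b ≡ true) → χ a ℤ.≤ χ b
χ-mono {false} {b} _ = χ-nonneg b
χ-mono {true}  h rewrite h refl = ℤP.≤-refl

χ-∨-∧ : ∀ a b → χ (a ∨ b) ℤ.+ χ (a ∧ b) ≡ χ a ℤ.+ χ b
χ-∨-∧ true  true  = refl
χ-∨-∧ true  false = refl
χ-∨-∧ false true  = refl
χ-∨-∧ false false = refl

χ-submodular : ∀ a b {x y} → (x ≡ true → a ∨ b ≡ true) → (y ≡ true → a ∧ b ≡ true) →
               χ x ℤ.+ χ y ℤ.≤ χ a ℤ.+ χ b
χ-submodular a b x⇒ y⇒ = subst (_ ℤ.≤_) (χ-∨-∧ a b) (ℤP.+-mono-≤ (χ-mono x⇒) (χ-mono y⇒))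

false≢true : false ≢ true
false≢true ()

∧≡true : ∀ {a b} → a ∧ b ≡ true → a ≡ true × b ≡ true
∧≡true {true} {true} _ = refl , refl

∨≡true : ∀ {a b} → a ∨ b ≡ true → a ≡ true ⊎ b ≡ true
∨≡true {true}         _ = inj₁ refl
∨≡true {false} {true} _ = inj₂ refl

≡-ext-Bool : ∀ {a b} → (a ≡ true → b ≡ true) → (b ≡ true → a ≡ true) → a ≡ b
≡-ext-Bool {false} {false} _ _ = refl
≡-ext-Bool {false} {true}  _ g = g refl
≡-ext-Bool {true}          f _ = sym (f refl)

does-≟⇒≡ : ∀ {k} {a b : Fin k} → does (a ≟ b) ≡ true → a ≡ b
does-≟⇒≡ {a = a} {b} h with a ≟ b
... | yes a≡b = a≡b
... | no  _   = ⊥-elim (false≢true h)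

ind : Bool → ℕ
ind b = if b then 1 else 0

ind-mono : ∀ {a b} → (a ≡ true → b ≡ true) → ind a ≤ ind b
ind-mono {false} _ = z≤n
ind-mono {true}  h rewrite h refl = ℕP.≤-refl

+-cancelʳ-≤ : ∀ a b c → a ℤ.+ c ℤ.≤ b ℤ.+ c → a ℤ.≤ b
+-cancelʳ-≤ a b c h = subst₂ ℤ._≤_ (cancel a c) (cancel b c) (ℤP.+-monoˡ-≤ (- c) h)
  where
  cancel : ∀ x y → x ℤ.+ y ℤ.- y ≡ x
  cancel = solve-∀

+-cancelˡ-≤ : ∀ a b c → a ℤ.+ b ℤ.≤ a ℤ.+ c → b ℤ.≤ c
+-cancelˡ-≤ a b c h = +-cancelʳ-≤ b c a (subst₂ ℤ._≤_ (ℤP.+-comm a b) (ℤP.+-comm a c) h)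

+≡⇒≡- : ∀ {a b c} → a ℤ.+ b ≡ c → a ≡ c ℤ.- b
+≡⇒≡- {a} {b} refl = cancel a b
  where
  cancel : ∀ x y → x ≡ (x ℤ.+ y) ℤ.- y
  cancel = solve-∀

shifted-violation : ∀ a b W O → W ℤ.≤ O → ¬ (W ℤ.- χ a ℤ.≤ O ℤ.- χ b) →
                    a ≡ false × b ≡ true × O ℤ.≤ W
shifted-violation true b W O W≤O ≰ = ⊥-elim (≰ (ℤP.+-mono-≤ W≤O (ℤP.neg-mono-≤ (χ-≤1 b))))
shifted-violation false false W O W≤O ≰ = ⊥-elim (≰ (ℤP.+-monoˡ-≤ (- + 0) W≤O))
shifted-violation false true W O W≤O ≰ =
  refl , refl , subst₂ ℤ._≤_ (cancel O) (ℤP.+-identityʳ W) (ℤP.i<j⇒suc[i]≤j (ℤP.≰⇒> ≰))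
  where
  cancel : ∀ x → + 1 ℤ.+ (x ℤ.- + 1) ≡ x
  cancel = solve-∀

sumFin-cong : ∀ {k} {f g : Fin k → ℕ} → (∀ j → f j ≡ g j) → sumFin f ≡ sumFin g
sumFin-cong {zero}  _ = refl
sumFin-cong {suc k} h = cong₂ _+_ (h zero) (sumFin-cong (λ j → h (suc j)))

sumFin-mono-≤ : ∀ {k} {f g : Fin k → ℕ} → (∀ j → f j ≤ g j) → sumFin f ≤ sumFin g
sumFin-mono-≤ {zero}  _ = z≤n
sumFin-mono-≤ {suc k} h = ℕP.+-mono-≤ (h zero) (sumFin-mono-≤ (λ j → h (suc j)))

sumFin-zero : ∀ {k} → sumFin {k} (λ _ → 0) ≡ 0
sumFin-zero {zero}  = refl
sumFin-zero {suc k} = sumFin-zero {k}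

pos-sumFin : ∀ {k} (f : Fin k → ℕ) → + sumFin f ≡ sumFinℤ (λ j → + f j)
pos-sumFin {zero}  f = refl
pos-sumFin {suc k} f =
  trans (ℤP.pos-+ (f zero) _) (cong (λ z → + f zero ℤ.+ z) (pos-sumFin (λ j → f (suc j))))

sumFinℤ-cong : ∀ {k} {f g : Fin k → ℤ} → (∀ j → f j ≡ g j) → sumFinℤ f ≡ sumFinℤ g
sumFinℤ-cong {zero}  _ = refl
sumFinℤ-cong {suc k} h = cong₂ ℤ._+_ (h zero) (sumFinℤ-cong (λ j → h (suc j)))

sumFinℤ-zero : ∀ {k} → sumFinℤ {k} (λ _ → + 0) ≡ + 0
sumFinℤ-zero {zero}  = refl
sumFinℤ-zero {suc k} = trans (ℤP.+-identityˡ _) (sumFinℤ-zero {k})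

sumFinℤ-+ : ∀ {k} (f g : Fin k → ℤ) → sumFinℤ (λ j → f j ℤ.+ g j) ≡ sumFinℤ f ℤ.+ sumFinℤ g
sumFinℤ-+ {zero}  f g = refl
sumFinℤ-+ {suc k} f g =
  trans (cong (λ z → (f zero ℤ.+ g zero) ℤ.+ z) (sumFinℤ-+ (λ j → f (suc j)) (λ j → g (suc j))))
        (interchange (f zero) (g zero) _ _)
  where
  interchange : ∀ a b c d → (a ℤ.+ b) ℤ.+ (c ℤ.+ d) ≡ (a ℤ.+ c) ℤ.+ (b ℤ.+ d)
  interchange = solve-∀

sumFinℤ-* : ∀ {k} a (f : Fin k → ℤ) → sumFinℤ (λ j → a ℤ.* f j) ≡ a ℤ.* sumFinℤ f
sumFinℤ-* {zero}  a f = sym (ℤP.*-zeroʳ a)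
sumFinℤ-* {suc k} a f =
  trans (cong (λ z → a ℤ.* f zero ℤ.+ z) (sumFinℤ-* a (λ j → f (suc j))))
        (sym (ℤP.*-distribˡ-+ a (f zero) _))

sumFinℤ-mono-≤ : ∀ {k} {f g : Fin k → ℤ} → (∀ j → f j ℤ.≤ g j) → sumFinℤ f ℤ.≤ sumFinℤ g
sumFinℤ-mono-≤ {zero}  _ = ℤP.≤-refl
sumFinℤ-mono-≤ {suc k} h = ℤP.+-mono-≤ (h zero) (sumFinℤ-mono-≤ (λ j → h (suc j)))

sumFinℤ-point : ∀ {k} (j₀ : Fin k) (f : Fin k → ℤ) →
                sumFinℤ (λ j → if does (j₀ ≟ j) then f j else + 0) ≡ f j₀
sumFinℤ-point {suc k} zero f =
  trans (cong (λ z → f zero ℤ.+ z) (sumFinℤ-zero {k})) (ℤP.+-identityʳ (f zero))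
sumFinℤ-point {suc k} (suc j₀) f =
  trans (ℤP.+-identityˡ _) (sumFinℤ-point j₀ (λ j → f (suc j)))

card : ∀ {N} → (Fin N → Bool) → ℤ
card p = sumFinℤ (λ y → χ (p y))

count≡card : ∀ {N} (p : Fin N → Bool) → + count p ≡ card p
count≡card p = trans (pos-sumFin (λ y → ind (p y))) (sumFinℤ-cong (λ y → pos-ind (p y)))
  where
  pos-ind : ∀ b → + ind b ≡ χ b
  pos-ind true  = refl
  pos-ind false = refl

Σ² : ∀ {N n} → (Fin N → Fin n → ℤ) → ℤ
Σ² f = sumFinℤ (λ x → sumFinℤ (f x))

Σ²-cong : ∀ {N n} {f g : Fin N → Fin n → ℤ} → (∀ x i → f x i ≡ g x i) → Σ² f ≡ Σ² g
Σ²-cong h = sumFinℤ-cong (λ x → sumFinℤ-cong (h x))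

Σ²-zero : ∀ {N n} → Σ² {N} {n} (λ _ _ → + 0) ≡ + 0
Σ²-zero {N} {n} = trans (sumFinℤ-cong {N} (λ _ → sumFinℤ-zero {n})) (sumFinℤ-zero {N})

Σ²-+ : ∀ {N n} (f g : Fin N → Fin n → ℤ) → Σ² (λ x i → f x i ℤ.+ g x i) ≡ Σ² f ℤ.+ Σ² g
Σ²-+ f g = trans (sumFinℤ-cong (λ x → sumFinℤ-+ (f x) (g x)))
                 (sumFinℤ-+ (λ x → sumFinℤ (f x)) (λ x → sumFinℤ (g x)))

Σ²-* : ∀ {N n} a (f : Fin N → Fin n → ℤ) → Σ² (λ x i → a ℤ.* f x i) ≡ a ℤ.* Σ² f
Σ²-* a f = trans (sumFinℤ-cong (λ x → sumFinℤ-* a (f x))) (sumFinℤ-* a (λ x → sumFinℤ (f x)))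

Σ²-- : ∀ {N n} (f g : Fin N → Fin n → ℤ) → Σ² (λ x i → f x i ℤ.- g x i) ≡ Σ² f ℤ.- Σ² g
Σ²-- f g = trans (Σ²-+ f (λ x i → - g x i))
                 (cong (λ z → Σ² f ℤ.+ z) (trans (Σ²-cong (λ x i → neg≡ (g x i)))
                                   (trans (Σ²-* (- + 1) g) (sym (neg≡ (Σ² g))))))
  where
  neg≡ : ∀ z → - z ≡ (- + 1) ℤ.* z
  neg≡ = solve-∀

Σ²-mono-≤ : ∀ {N n} {f g : Fin N → Fin n → ℤ} → (∀ x i → f x i ℤ.≤ g x i) → Σ² f ℤ.≤ Σ² g
Σ²-mono-≤ h = sumFinℤ-mono-≤ (λ x → sumFinℤ-mono-≤ (h x))

Σ²-point : ∀ {N n} (x₀ : Fin N) (i₀ : Fin n) (f : Fin N → Fin n → ℤ) →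
  Σ² (λ x i → if does (x₀ ≟ x) then (if does (i₀ ≟ i) then f x i else + 0) else + 0) ≡ f x₀ i₀
Σ²-point {N} {n} x₀ i₀ f =
  trans (sumFinℤ-cong (λ x → row x (does (x₀ ≟ x)))) (sumFinℤ-point x₀ (λ x → f x i₀))
  where
  row : ∀ x b → sumFinℤ (λ i → if b then (if does (i₀ ≟ i) then f x i else + 0) else + 0)
              ≡ (if b then f x i₀ else + 0)
  row x true  = sumFinℤ-point i₀ (f x)
  row x false = sumFinℤ-zero {n}

_≗ᶜ_ : ∀ {N n} → ColorSet N n → ColorSet N n → Set
S ≗ᶜ T = ∀ x i → S x i ≡ T x i

_∪_ : ∀ {N n} → ColorSet N n → ColorSet N n → ColorSet N n
(S ∪ T) x i = S x i ∨ T x i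

_∩_ : ∀ {N n} → ColorSet N n → ColorSet N n → ColorSet N n
(S ∩ T) x i = S x i ∧ T x i

∅ : ∀ {N n} → ColorSet N n
∅ _ _ = false

⁅_,_⁆ : ∀ {N n} → Fin N → Fin n → ColorSet N n
⁅ x₀ , i₀ ⁆ x i = does (x₀ ≟ x) ∧ does (i₀ ≟ i)

weight : ∀ {N n} → ColorSet N n → (Fin N → Fin n → ℤ) → ℤ
weight S c = Σ² (λ x i → if S x i then c x i else + 0)

weight-cong : ∀ {N n} {S T : ColorSet N n} c → S ≗ᶜ T → weight S c ≡ weight T c
weight-cong c h = Σ²-cong (λ x i → cong (λ b → if b then c x i else + 0) (h x i))

size≡weight : ∀ {N n} (S : ColorSet N n) → + size S ≡ weight S (λ _ _ → + 1)
size≡weight S = trans (pos-sumFin (λ x → count (S x))) (sumFinℤ-cong (λ x → count≡card (S x)))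

weight-const : ∀ {N n} (S : ColorSet N n) a → weight S (λ _ _ → a) ≡ a ℤ.* + size S
weight-const S a =
  trans (Σ²-cong (λ x i → scale (S x i)))
        (trans (Σ²-* a (λ x i → χ (S x i))) (cong (a ℤ.*_) (sym (size≡weight S))))
  where
  scale : ∀ s → (if s then a else + 0) ≡ a ℤ.* χ s
  scale true  = sym (ℤP.*-identityʳ a)
  scale false = sym (ℤP.*-zeroʳ a)

weight-mono-≤ : ∀ {N n} (S : ColorSet N n) {c c′} → (∀ x i → c x i ℤ.≤ c′ x i) →
                weight S c ℤ.≤ weight S c′
weight-mono-≤ S h = Σ²-mono-≤ (λ x i → restrict (S x i) (h x i))
  where
  restrict : ∀ s {a b} → a ℤ.≤ b → (if s then a else + 0) ℤ.≤ (if s then b else + 0)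
  restrict true  a≤b = a≤b
  restrict false _   = ℤP.≤-refl

weight-∪-∩ : ∀ {N n} (S T : ColorSet N n) c →
             weight (S ∪ T) c ℤ.+ weight (S ∩ T) c ≡ weight S c ℤ.+ weight T c
weight-∪-∩ S T c =
  trans (sym (Σ²-+ (restrict (S ∪ T)) (restrict (S ∩ T))))
        (trans (Σ²-cong (λ x i → pointwise (S x i) (T x i) (c x i))) (Σ²-+ (restrict S) (restrict T)))
  where
  restrict : ColorSet _ _ → Fin _ → Fin _ → ℤ
  restrict R x i = if R x i then c x i else + 0
  pointwise : ∀ s t a → (if s ∨ t then a else + 0) ℤ.+ (if s ∧ t then a else + 0)
                      ≡ (if s then a else + 0) ℤ.+ (if t then a else + 0)
  pointwise true  true  a = refl
  pointwise true  false a = trans (ℤP.+-identityʳ a) (sym (ℤP.+-identityʳ a))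
  pointwise false true  a = trans (ℤP.+-identityʳ a) (sym (ℤP.+-identityˡ a))
  pointwise false false a = refl

weight-∪-point : ∀ {N n} (U : ColorSet N n) x₀ i₀ c → U x₀ i₀ ≡ false →
                 weight (U ∪ ⁅ x₀ , i₀ ⁆) c ≡ weight U c ℤ.+ c x₀ i₀
weight-∪-point U x₀ i₀ c U∌ =
  trans (Σ²-cong (λ x i → pointwise x i (U x i) (does (x₀ ≟ x)) (does (i₀ ≟ i)) refl refl refl))
        (trans (Σ²-+ (λ x i → if U x i then c x i else + 0)
                     (λ x i → if does (x₀ ≟ x) then (if does (i₀ ≟ i) then c x i else + 0) else + 0))
               (cong (λ z → weight U c ℤ.+ z) (Σ²-point x₀ i₀ c)))
  where
  pointwise : ∀ x i u a b → U x i ≡ u → does (x₀ ≟ x) ≡ a → does (i₀ ≟ i) ≡ b →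
              (if u ∨ (a ∧ b) then c x i else + 0)
                ≡ (if u then c x i else + 0) ℤ.+ (if a then (if b then c x i else + 0) else + 0)
  pointwise x i true true true eu ea eb =
    ⊥-elim (false≢true (trans (sym U∌) (trans (cong₂ U (does-≟⇒≡ ea) (does-≟⇒≡ eb)) eu)))
  pointwise x i true  true  false _ _ _ = sym (ℤP.+-identityʳ _)
  pointwise x i true  false _     _ _ _ = sym (ℤP.+-identityʳ _)
  pointwise x i false true  true  _ _ _ = sym (ℤP.+-identityˡ _)
  pointwise x i false true  false _ _ _ = refl
  pointwise x i false false _     _ _ _ = refl

size-cong : ∀ {N n} {S T : ColorSet N n} → S ≗ᶜ T → size S ≡ size T
size-cong h = sumFin-cong (λ x → sumFin-cong (λ i → cong ind (h x i)))

size-∅ : ∀ {N n} → size {N} {n} ∅ ≡ 0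
size-∅ {N} {n} = trans (sumFin-cong {N} (λ _ → sumFin-zero {n})) (sumFin-zero {N})

size-∪-point : ∀ {N n} (U : ColorSet N n) x₀ i₀ → U x₀ i₀ ≡ false →
               size (U ∪ ⁅ x₀ , i₀ ⁆) ≡ size U + 1
size-∪-point U x₀ i₀ U∌ = ℤP.+-injective (begin
  + size (U ∪ ⁅ x₀ , i₀ ⁆)              ≡⟨ size≡weight (U ∪ ⁅ x₀ , i₀ ⁆) ⟩
  weight (U ∪ ⁅ x₀ , i₀ ⁆) (λ _ _ → + 1) ≡⟨ weight-∪-point U x₀ i₀ (λ _ _ → + 1) U∌ ⟩
  weight U (λ _ _ → + 1) ℤ.+ + 1         ≡⟨ cong (ℤ._+ + 1) (size≡weight U) ⟨
  + size U ℤ.+ + 1                       ≡⟨ ℤP.pos-+ (size U) 1 ⟨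
  + (size U + 1)                         ∎)
  where open ≡-Reasoning

size-mono : ∀ {N n} {S T : ColorSet N n} → S ⊆ᶜ T → size S ≤ size T
size-mono h = sumFin-mono-≤ (λ x → sumFin-mono-≤ (λ i → ind-mono (h x i)))

size-∪-∩ : ∀ {N n} (S T : ColorSet N n) → size (S ∪ T) + size (S ∩ T) ≡ size S + size T
size-∪-∩ S T = ℤP.+-injective (begin
  + (size (S ∪ T) + size (S ∩ T))           ≡⟨ ℤP.pos-+ (size (S ∪ T)) _ ⟩
  + size (S ∪ T) ℤ.+ + size (S ∩ T)
                        ≡⟨ cong₂ ℤ._+_ (size≡weight (S ∪ T)) (size≡weight (S ∩ T)) ⟩
  weight (S ∪ T) one ℤ.+ weight (S ∩ T) one ≡⟨ weight-∪-∩ S T one ⟩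
  weight S one ℤ.+ weight T one             ≡⟨ cong₂ ℤ._+_ (size≡weight S) (size≡weight T) ⟨
  + size S ℤ.+ + size T                      ≡⟨ ℤP.pos-+ (size S) _ ⟨
  + (size S + size T)                        ∎)
  where
  open ≡-Reasoning
  one : Fin _ → Fin _ → ℤ
  one _ _ = + 1

size-∪ : ∀ {N n} (S T : ColorSet N n) → size (S ∪ T) ≤ size S + size T
size-∪ S T = subst (size (S ∪ T) ≤_) (size-∪-∩ S T) (ℕP.m≤m+n _ _)

card-mono : ∀ {N} {p q : Fin N → Bool} → (∀ y → p y ≡ true → q y ≡ true) → card p ℤ.≤ card q
card-mono h = sumFinℤ-mono-≤ (λ y → χ-mono (h y))

card-∨ : ∀ {N} (p q : Fin N → Bool) → card (λ y → p y ∨ q y) ℤ.≤ card p ℤ.+ card q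
card-∨ p q = subst (card (λ y → p y ∨ q y) ℤ.≤_) (sumFinℤ-+ (λ y → χ (p y)) (λ y → χ (q y)))
                   (sumFinℤ-mono-≤ (λ y → pointwise (p y) (q y)))
  where
  pointwise : ∀ a b → χ (a ∨ b) ℤ.≤ χ a ℤ.+ χ b
  pointwise true  true  = +≤+ (s≤s z≤n)
  pointwise true  false = ℤP.≤-refl
  pointwise false b     = ℤP.≤-reflexive (sym (ℤP.+-identityˡ (χ b)))

card-∖ : ∀ {N} (p q : Fin N → Bool) → card p ℤ.≤ card (λ y → p y ∧ not (q y)) ℤ.+ card q
card-∖ p q = subst (card p ℤ.≤_) (sumFinℤ-+ (λ y → χ (p y ∧ not (q y))) (λ y → χ (q y)))
                   (sumFinℤ-mono-≤ (λ y → pointwise (p y) (q y)))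
  where
  pointwise : ∀ a b → χ a ℤ.≤ χ (a ∧ not b) ℤ.+ χ b
  pointwise true  true  = ℤP.≤-refl
  pointwise true  false = ℤP.≤-refl
  pointwise false true  = +≤+ z≤n
  pointwise false false = ℤP.≤-refl

card-Image : ∀ {N k} (φ : Fin k → Fin N) → card (Image φ) ℤ.≤ + k
card-Image {N} {zero}  φ = ℤP.≤-reflexive (sumFinℤ-zero {N})
card-Image {N} {suc k} φ = begin
  card (Image φ)                              ≤⟨ card-∨ (λ y → does (φ zero ≟ y)) (Image φ′) ⟩
  card (λ y → does (φ zero ≟ y)) ℤ.+ card (Image φ′)
                            ≡⟨ cong (ℤ._+ card (Image φ′)) (sumFinℤ-point (φ zero) (λ _ → + 1)) ⟩
  + 1 ℤ.+ card (Image φ′)                     ≤⟨ ℤP.+-monoʳ-≤ (+ 1) (card-Image φ′) ⟩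
  + suc k                                     ∎
  where
  open ℤP.≤-Reasoning
  φ′ : Fin k → Fin N
  φ′ u = φ (suc u)

anyFin⇒∃ : ∀ {k} {p : Fin k → Bool} → anyFin p ≡ true → ∃ λ j → p j ≡ true
anyFin⇒∃ {suc k} {p} h with p zero in eq
... | true  = zero , eq
... | false with anyFin⇒∃ {k} {λ j → p (suc j)} h
...   | j , pj = suc j , pj

∃⇒anyFin : ∀ {k} {p : Fin k → Bool} j → p j ≡ true → anyFin p ≡ true
∃⇒anyFin {suc k} {p} zero    h rewrite h = refl
∃⇒anyFin {suc k} {p} (suc j) h rewrite ∃⇒anyFin {k} {λ j → p (suc j)} j h = BoolP.∨-zeroʳ (p zero)

Nbhd⇒∃ : ∀ {N n} (Gs : Fin n → Graph N) S y → Nbhd Gs S y ≡ true →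
         ∃ λ u → ∃ λ i → S u i ≡ true × Gs i u y ≡ true
Nbhd⇒∃ Gs S y h with anyFin⇒∃ h
... | u , h′ with anyFin⇒∃ h′
...   | i , h″ = u , i , ∧≡true h″

∃⇒Nbhd : ∀ {N n} (Gs : Fin n → Graph N) S y u i → S u i ≡ true → Gs i u y ≡ true →
         Nbhd Gs S y ≡ true
∃⇒Nbhd Gs S y u i Sui Gsuy = ∃⇒anyFin u (∃⇒anyFin i (cong₂ _∧_ Sui Gsuy))

Nbhd-mono : ∀ {N n} (Gs : Fin n → Graph N) {S T} → S ⊆ᶜ T →
            ∀ y → Nbhd Gs S y ≡ true → Nbhd Gs T y ≡ true
Nbhd-mono Gs {S} {T} S⊆T y h with Nbhd⇒∃ Gs S y h
... | u , i , Sui , Gsuy = ∃⇒Nbhd Gs T y u i (S⊆T u i Sui) Gsuy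

Nbhd-cong : ∀ {N n} (Gs : Fin n → Graph N) {S T} → S ≗ᶜ T → ∀ y → Nbhd Gs S y ≡ Nbhd Gs T y
Nbhd-cong Gs h y = ≡-ext-Bool (Nbhd-mono Gs (λ x i → subst (_≡ true) (h x i)) y)
                              (Nbhd-mono Gs (λ x i → subst (_≡ true) (sym (h x i))) y)

Nbhd-∪ : ∀ {N n} (Gs : Fin n → Graph N) S T y → Nbhd Gs (S ∪ T) y ≡ true →
         Nbhd Gs S y ∨ Nbhd Gs T y ≡ true
Nbhd-∪ Gs S T y h with Nbhd⇒∃ Gs (S ∪ T) y h
... | u , i , h₁ , h₂ with ∨≡true {S u i} h₁
...   | inj₁ Sui rewrite ∃⇒Nbhd Gs S y u i Sui h₂ = refl
...   | inj₂ Tui rewrite ∃⇒Nbhd Gs T y u i Tui h₂ = BoolP.∨-zeroʳ _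

Nbhd-∩ : ∀ {N n} (Gs : Fin n → Graph N) S T y → Nbhd Gs (S ∩ T) y ≡ true →
         Nbhd Gs S y ∧ Nbhd Gs T y ≡ true
Nbhd-∩ Gs S T y h with Nbhd⇒∃ Gs (S ∩ T) y h
... | u , i , h₁ , h₂ with ∧≡true {S u i} h₁
...   | Sui , Tui = cong₂ _∧_ (∃⇒Nbhd Gs S y u i Sui h₂) (∃⇒Nbhd Gs T y u i Tui h₂)

Nbhd-∅ : ∀ {N n} (Gs : Fin n → Graph N) y → Nbhd Gs ∅ y ≡ false
Nbhd-∅ Gs y = BoolP.¬-not λ h → let _ , _ , ∅ui , _ = Nbhd⇒∃ Gs ∅ y h in false≢true ∅ui

Nbhd-point : ∀ {N n} (Gs : Fin n → Graph N) x₀ i₀ y →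
             Nbhd Gs ⁅ x₀ , i₀ ⁆ y ≡ true → Gs i₀ x₀ y ≡ true
Nbhd-point Gs x₀ i₀ y h with Nbhd⇒∃ Gs ⁅ x₀ , i₀ ⁆ y h
... | u , i , u,i≡x₀,i₀ , Gsuy with ∧≡true {does (x₀ ≟ u)} u,i≡x₀,i₀
...   | u≡x₀ , i≡i₀ =
  subst₂ (λ a j → Gs j a y ≡ true) (sym (does-≟⇒≡ u≡x₀)) (sym (does-≟⇒≡ i≡i₀)) Gsuy

outside : ∀ {N n} → (Fin n → Graph N) → (Fin N → Bool) → ColorSet N n → ℤ
outside Gs I S = card (λ y → Nbhd Gs S y ∧ not (I y))

outside-cong : ∀ {N n} (Gs : Fin n → Graph N) I {S T} → S ≗ᶜ T → outside Gs I S ≡ outside Gs I T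
outside-cong Gs I h = sumFinℤ-cong (λ y → cong (λ b → χ (b ∧ not (I y))) (Nbhd-cong Gs h y))

outside-∅ : ∀ {N n} (Gs : Fin n → Graph N) I → outside Gs I ∅ ≡ + 0
outside-∅ {N} Gs I =
  trans (sumFinℤ-cong (λ y → cong (λ b → χ (b ∧ not (I y))) (Nbhd-∅ Gs y))) (sumFinℤ-zero {N})

outside-submodular : ∀ {N n} (Gs : Fin n → Graph N) I S T →
  outside Gs I (S ∪ T) ℤ.+ outside Gs I (S ∩ T) ℤ.≤ outside Gs I S ℤ.+ outside Gs I T
outside-submodular Gs I S T =
  subst₂ ℤ._≤_ (sumFinℤ-+ (χ-out (S ∪ T)) (χ-out (S ∩ T))) (sumFinℤ-+ (χ-out S) (χ-out T))
    (sumFinℤ-mono-≤ λ y → pointwise (Nbhd Gs S y) (Nbhd Gs T y) (I y) (Nbhd-∪ Gs S T y) (Nbhd-∩ Gs S T y))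
  where
  χ-out : ColorSet _ _ → Fin _ → ℤ
  χ-out R y = χ (Nbhd Gs R y ∧ not (I y))
  pointwise : ∀ a b i {x y} → (x ≡ true → a ∨ b ≡ true) → (y ≡ true → a ∧ b ≡ true) →
              χ (x ∧ not i) ℤ.+ χ (y ∧ not i) ℤ.≤ χ (a ∧ not i) ℤ.+ χ (b ∧ not i)
  pointwise a b true {x} {y} _ _
    rewrite BoolP.∧-zeroʳ a | BoolP.∧-zeroʳ b | BoolP.∧-zeroʳ x | BoolP.∧-zeroʳ y = ℤP.≤-refl
  pointwise a b false {x} {y} hx hy
    rewrite BoolP.∧-identityʳ a | BoolP.∧-identityʳ b | BoolP.∧-identityʳ x | BoolP.∧-identityʳ y =
    χ-submodular a b hx hy

cost : ∀ {N n k} → List (Edge k n) → (Fin k → Fin N) → ℕ → Fin N → Fin n → ℤ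
cost E φ D x i = χ (InSet E φ x i) ℤ.+ (+ D ℤ.- + dcol E φ i x)

WeightBound : ∀ {N n k} → (Fin n → Graph N) → List (Edge k n) → (Fin k → Fin N) →
              ℕ → ℕ → ColorSet N n → Set
WeightBound Gs E φ m D A =
  ∀ S → S ⊆ᶜ A → size S ≤ m → weight S (cost E φ D) ℤ.≤ outside Gs (Image φ) S

goodness-lhs≡weight : ∀ {N n k} (E : List (Edge k n)) (φ : Fin k → Fin N) D (S : ColorSet N n) →
  + size (λ x i → S x i ∧ InSet E φ x i) ℤ.+ Σ² (λ x i → if S x i then + D ℤ.- + dcol E φ i x else + 0)
  ≡ weight S (cost E φ D)
goodness-lhs≡weight E φ D S =
  trans (cong (ℤ._+ Σ² slack) (size≡weight (λ x i → S x i ∧ InSet E φ x i)))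
        (trans (sym (Σ²-+ (λ x i → χ (S x i ∧ InSet E φ x i)) slack))
               (Σ²-cong (λ x i → pointwise (S x i) (InSet E φ x i) (+ D ℤ.- + dcol E φ i x))))
  where
  slack : Fin _ → Fin _ → ℤ
  slack x i = if S x i then + D ℤ.- + dcol E φ i x else + 0
  pointwise : ∀ s b a → χ (s ∧ b) ℤ.+ (if s then a else + 0) ≡ (if s then χ b ℤ.+ a else + 0)
  pointwise true  b a = refl
  pointwise false b a = refl

module _ {N n k} (Gs : Fin n → Graph N) (E : List (Edge k n)) (φ : Fin k → Fin N) (m D : ℕ)
         (A : ColorSet N n) where

  IsGood⇒WeightBound : IsGood Gs E φ m D A → WeightBound Gs E φ m D A
  IsGood⇒WeightBound good S S⊆A |S|≤m =
    subst₂ ℤ._≤_ (goodness-lhs≡weight E φ D S) (count≡card (λ y → Nbhd Gs S y ∧ not (Image φ y)))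
           (good S S⊆A |S|≤m)

  WeightBound⇒IsGood : WeightBound Gs E φ m D A → IsGood Gs E φ m D A
  WeightBound⇒IsGood bound S S⊆A |S|≤m =
    subst₂ ℤ._≤_ (sym (goodness-lhs≡weight E φ D S))
                 (sym (count≡card (λ y → Nbhd Gs S y ∧ not (Image φ y))))
           (bound S S⊆A |S|≤m)

Searchable : (X : Set) → (X → X → Set) → Set₁
Searchable X _≈_ =
  (P : X → Set) → (∀ {x y} → x ≈ y → P x → P y) → (∀ x → Dec (P x)) → Dec (∃ P)

search-Bool : Searchable Bool _≡_
search-Bool P _ P? with P? true | P? false
... | yes p | _     = yes (true , p)
... | no _  | yes p = yes (false , p)
... | no ¬t | no ¬f = no λ { (true , p) → ¬t p ; (false , p) → ¬f p }

_◂_ : ∀ {X : Set} {a} → X → (Fin a → X) → Fin (suc a) → X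
(x ◂ g) zero    = x
(x ◂ g) (suc j) = g j

search-Fin→ : ∀ {X _≈_} → (∀ x → x ≈ x) → Searchable X _≈_ → ∀ a →
              Searchable (Fin a → X) (λ f g → ∀ j → f j ≈ g j)
search-Fin→ refl≈ search zero P respects P? with P? (λ ())
... | yes p = yes (_ , p)
... | no ¬p = no λ { (f , p) → ¬p (respects (λ ()) p) }
search-Fin→ {X} {_≈_} refl≈ search (suc a) P respects P?
  with search (λ x → ∃ λ g → P (x ◂ g))
              (λ x≈y (g , p) → g , respects (λ { zero → x≈y ; (suc j) → refl≈ (g j) }) p)
              (λ x → search-Fin→ refl≈ search a (λ g → P (x ◂ g))
                       (λ g≈h → respects (λ { zero → refl≈ x ; (suc j) → g≈h j }))
                       (λ g → P? (x ◂ g)))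
... | yes (x , g , p) = yes (x ◂ g , p)
... | no ¬p = no λ { (f , p) → ¬p (f zero , (λ j → f (suc j)) ,
                                   respects (λ { zero → refl≈ (f zero) ; (suc j) → refl≈ (f (suc j)) }) p) }

search-ColorSet : ∀ N n → Searchable (ColorSet N n) _≗ᶜ_
search-ColorSet N n = search-Fin→ (λ _ _ → refl) (search-Fin→ (λ _ → refl) search-Bool n) N

_⊆ᶜ?_ : ∀ {N n} (S A : ColorSet N n) → Dec (S ⊆ᶜ A)
S ⊆ᶜ? A = FinP.all? (λ x → FinP.all? (λ i → (S x i Bool.≟ true) →-dec (A x i Bool.≟ true)))

Violation : ∀ {N n k} → (Fin n → Graph N) → List (Edge k n) → (Fin k → Fin N) →
            ℕ → ℕ → ColorSet N n → ColorSet N n → Set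
Violation Gs E φ m D A S =
  S ⊆ᶜ A × size S ≤ m × ¬ (weight S (cost E φ D) ℤ.≤ outside Gs (Image φ) S)

-- Goodness quantifies over all colour-sets; deciding it is what lets us pick a good extension.
violation? : ∀ {N n k} Gs (E : List (Edge k n)) (φ : Fin k → Fin N) m D A →
             Dec (∃ (Violation Gs E φ m D A))
violation? {N} {n} Gs E φ m D A =
  search-ColorSet N n _ respects
    (λ S → (S ⊆ᶜ? A) ×-dec (size S ℕ.≤? m)
             ×-dec ¬? (weight S (cost E φ D) ℤ.≤? outside Gs (Image φ) S))
  where
  respects : ∀ {S T} → S ≗ᶜ T → Violation Gs E φ m D A S → Violation Gs E φ m D A T
  respects S≗T (S⊆A , |S|≤m , ¬bound) =
    (λ x i → S⊆A x i ∘′ subst (_≡ true) (sym (S≗T x i))) ,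
    subst (_≤ m) (size-cong S≗T) |S|≤m ,
    λ bound → ¬bound (subst₂ ℤ._≤_ (sym (weight-cong (cost E φ D) S≗T))
                                  (sym (outside-cong Gs (Image φ) S≗T)) bound)

¬Violation⇒WeightBound : ∀ {N n k} Gs (E : List (Edge k n)) (φ : Fin k → Fin N) m D A →
                         ¬ ∃ (Violation Gs E φ m D A) → WeightBound Gs E φ m D A
¬Violation⇒WeightBound Gs E φ m D A ¬viol S S⊆A |S|≤m
  with weight S (cost E φ D) ℤ.≤? outside Gs (Image φ) S
... | yes bound  = bound
... | no ¬bound  = ⊥-elim (¬viol (S , S⊆A , |S|≤m , ¬bound))

incident-≢ : ∀ {k n} (w : Fin (suc k)) (e : Edge (suc k) n) → w ≢ src e → w ≢ tgt e →
             incident e w ≡ false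
incident-≢ w e w≢s w≢t =
  cong₂ _∨_ (dec-false (src e ≟ w) (w≢s ∘′ sym)) (dec-false (tgt e ≟ w) (w≢t ∘′ sym))

incident-src : ∀ {k n} (w : Fin (suc k)) (e : Edge (suc k) n) → w ≡ src e → incident e w ≡ true
incident-src w e w≡s rewrite dec-true (src e ≟ w) (sym w≡s) = refl

incident-tgt : ∀ {k n} (w : Fin (suc k)) (e : Edge (suc k) n) → w ≡ tgt e → incident e w ≡ true
incident-tgt w e w≡t rewrite dec-true (tgt e ≟ w) (sym w≡t) = BoolP.∨-zeroʳ _

Restricts : ∀ {k n} → Fin (suc k) → (Edge (suc k) n → Bool) → (Edge k n → Bool) → Set
Restricts w q q′ =
  ∀ s t c (w≢s : w ≢ s) (w≢t : w ≢ t) → q (s ⟶ t ∶ c) ≡ q′ (punchOut w≢s ⟶ punchOut w≢t ∶ c)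

private
  open import Algebra.Properties.CommutativeSemigroup ℕP.+-commutativeSemigroup
    using (x∙yz≈y∙xz)
  open import Algebra.Properties.CommutativeSemigroup
    (CommutativeMonoid.commutativeSemigroup BoolP.∨-commutativeMonoid)
    using () renaming (x∙yz≈y∙xz to x∨yz≡y∨xz)

  keep-edge : ∀ a {a′ i : Bool} r d {c} → a ≡ a′ → i ≡ false → c ≡ r + d →
              ind a + c ≡ (ind a′ + r) + (ind (i ∧ a) + d)
  keep-edge a r d refl refl refl = sym (ℕP.+-assoc _ r d)

  drop-edge : ∀ a {i : Bool} r d {c} → i ≡ true → c ≡ r + d → ind a + c ≡ r + (ind (i ∧ a) + d)
  drop-edge a r d refl refl = x∙yz≈y∙xz (ind a) r d

  keep-edge∨ : ∀ a {a′ i : Bool} r d {c} → a ≡ a′ → i ≡ false → c ≡ r ∨ d →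
               a ∨ c ≡ (a′ ∨ r) ∨ ((i ∧ a) ∨ d)
  keep-edge∨ a r d refl refl refl = sym (BoolP.∨-assoc a r d)

  drop-edge∨ : ∀ a {i : Bool} r d {c} → i ≡ true → c ≡ r ∨ d → a ∨ c ≡ r ∨ ((i ∧ a) ∨ d)
  drop-edge∨ a r d refl refl = x∨yz≡y∨xz a r d

module _ {k n} (w : Fin (suc k)) (q : Edge (suc k) n → Bool) (q′ : Edge k n → Bool)
         (q≈q′ : Restricts w q q′) where
  private
    qʷ : Edge (suc k) n → Bool
    qʷ e = incident e w ∧ q e

  countList-removeVertex : ∀ L →
    countList q L ≡ countList q′ (removeVertex w L) + countList (λ e → incident e w ∧ q e) L
  countList-removeVertex [] = refl
  countList-removeVertex (e ∷ L) with w ≟ src e | w ≟ tgt e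
  ... | no w≢s  | no w≢t  = keep-edge (q e) (countList q′ (removeVertex w L)) (countList qʷ L)
                              (q≈q′ _ _ _ w≢s w≢t) (incident-≢ w e w≢s w≢t) (countList-removeVertex L)
  ... | yes w≡s | _       = drop-edge (q e) (countList q′ (removeVertex w L)) (countList qʷ L)
                              (incident-src w e w≡s) (countList-removeVertex L)
  ... | no _    | yes w≡t = drop-edge (q e) (countList q′ (removeVertex w L)) (countList qʷ L)
                              (incident-tgt w e w≡t) (countList-removeVertex L)

  anyList-removeVertex : ∀ L →
    anyList q L ≡ anyList q′ (removeVertex w L) ∨ anyList (λ e → incident e w ∧ q e) L
  anyList-removeVertex [] = refl
  anyList-removeVertex (e ∷ L) with w ≟ src e | w ≟ tgt e
  ... | no w≢s  | no w≢t  = keep-edge∨ (q e) (anyList q′ (removeVertex w L)) (anyList qʷ L)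
                              (q≈q′ _ _ _ w≢s w≢t) (incident-≢ w e w≢s w≢t) (anyList-removeVertex L)
  ... | yes w≡s | _       = drop-edge∨ (q e) (anyList q′ (removeVertex w L)) (anyList qʷ L)
                              (incident-src w e w≡s) (anyList-removeVertex L)
  ... | no _    | yes w≡t = drop-edge∨ (q e) (anyList q′ (removeVertex w L)) (anyList qʷ L)
                              (incident-tgt w e w≡t) (anyList-removeVertex L)

∈-removeVertex : ∀ {k n} (w : Fin (suc k)) {e : Edge (suc k) n} L → e ∈ L →
                 (w≢s : w ≢ src e) (w≢t : w ≢ tgt e) →
                 (punchOut w≢s ⟶ punchOut w≢t ∶ colour e) ∈ removeVertex w L
∈-removeVertex w (e ∷ L) (here refl) w≢s w≢t with w ≟ src e | w ≟ tgt e
... | yes w≡s | _       = ⊥-elim (w≢s w≡s)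
... | no _    | yes w≡t = ⊥-elim (w≢t w≡t)
... | no _    | no _    =
  here (cong₂ (λ a b → a ⟶ b ∶ colour e) (FinP.punchOut-cong w refl) (FinP.punchOut-cong w refl))
∈-removeVertex w (f ∷ L) (there e∈L) w≢s w≢t with w ≟ src f | w ≟ tgt f
... | yes _ | _     = ∈-removeVertex w L e∈L w≢s w≢t
... | no _  | yes _ = ∈-removeVertex w L e∈L w≢s w≢t
... | no _  | no _  = there (∈-removeVertex w L e∈L w≢s w≢t)

anyList⇒∃ : ∀ {a} {X : Set a} {p : X → Bool} L → anyList p L ≡ true → ∃ λ e → e ∈ L × p e ≡ true
anyList⇒∃ {p = p} (x ∷ L) h with p x in px
... | true  = x , here refl , px
... | false with anyList⇒∃ L h
...   | e , e∈L , pe = e , there e∈L , pe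

countList-mono : ∀ {a} {X : Set a} {p q : X → Bool} → (∀ e → p e ≡ true → q e ≡ true) →
                 ∀ L → countList p L ≤ countList q L
countList-mono p⇒q []      = z≤n
countList-mono p⇒q (x ∷ L) = ℕP.+-mono-≤ (ind-mono (p⇒q x)) (countList-mono p⇒q L)

module _ {a} {X : Set a} (p : X → Bool) where

  countList≡0⇒∉ : ∀ L {e} → countList p L ≡ 0 → e ∈ L → p e ≢ true
  countList≡0⇒∉ (x ∷ L) h (here refl) px rewrite px = ℕP.1+n≢0 h
  countList≡0⇒∉ (x ∷ L) h (there e∈L) pe with p x
  ... | false = countList≡0⇒∉ L h e∈L pe

  countList-∧≡0 : ∀ (q : X → Bool) L → countList p L ≡ 0 → countList (λ e → p e ∧ q e) L ≡ 0
  countList-∧≡0 q L h = ℕP.n≤0⇒n≡0 (subst (countList (λ e → p e ∧ q e) L ≤_) h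
                                       (countList-mono (λ e → proj₁ ∘′ ∧≡true) L))

  anyList-∧≡false : ∀ (q : X → Bool) L → countList p L ≡ 0 → anyList (λ e → p e ∧ q e) L ≡ false
  anyList-∧≡false q L h = BoolP.¬-not λ any →
    let e , e∈L , pqe = anyList⇒∃ L any in countList≡0⇒∉ L h e∈L (proj₁ (∧≡true pqe))

  module _ {e₀} (pe₀ : p e₀ ≡ true) where

    countList-∧-unique : ∀ (q : X → Bool) L → countList p L ≡ 1 → e₀ ∈ L →
                         countList (λ e → p e ∧ q e) L ≡ ind (q e₀)
    countList-∧-unique q (x ∷ L) h (here refl) with p x
    ... | true =
      trans (cong (λ z → ind (q x) + z) (countList-∧≡0 q L (ℕP.suc-injective h))) (ℕP.+-identityʳ _)
    countList-∧-unique q (x ∷ L) h (there e₀∈L) with p x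
    ... | true  = ⊥-elim (countList≡0⇒∉ L (ℕP.suc-injective h) e₀∈L pe₀)
    ... | false = countList-∧-unique q L h e₀∈L

    anyList-∧-unique : ∀ (q : X → Bool) L → countList p L ≡ 1 → e₀ ∈ L →
                       anyList (λ e → p e ∧ q e) L ≡ q e₀
    anyList-∧-unique q (x ∷ L) h (here refl) with p x
    ... | true = trans (cong (q x ∨_) (anyList-∧≡false q L (ℕP.suc-injective h))) (BoolP.∨-identityʳ _)
    anyList-∧-unique q (x ∷ L) h (there e₀∈L) with p x
    ... | true  = ⊥-elim (countList≡0⇒∉ L (ℕP.suc-injective h) e₀∈L pe₀)
    ... | false = anyList-∧-unique q L h e₀∈L

    countList≡1⇒≡ : ∀ L → countList p L ≡ 1 → e₀ ∈ L →
                    ∀ {e} → e ∈ L → p e ≡ true → e ≡ e₀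
    countList≡1⇒≡ (x ∷ L) h (here refl) (here refl) _ = refl
    countList≡1⇒≡ (x ∷ L) h (here refl) (there e∈L) pe with p x
    ... | true = ⊥-elim (countList≡0⇒∉ L (ℕP.suc-injective h) e∈L pe)
    countList≡1⇒≡ (x ∷ L) h (there e₀∈L) (here refl) pe with p x
    ... | true = ⊥-elim (countList≡0⇒∉ L (ℕP.suc-injective h) e₀∈L pe₀)
    countList≡1⇒≡ (x ∷ L) h (there e₀∈L) (there e∈L) pe with p x
    ... | true  = ⊥-elim (countList≡0⇒∉ L (ℕP.suc-injective h) e∈L pe)
    ... | false = countList≡1⇒≡ L h e₀∈L e∈L pe

degree-removeLeaf : ∀ {k n} (E : List (Edge (suc k) n)) {w v ℓ} (v′ : Fin k) → punchIn w v′ ≡ v →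
                    degree E w ≡ 1 → (v ⟶ w ∶ ℓ) ∈ E → degree E v ≡ degree (removeVertex w E) v′ + 1
degree-removeLeaf E {w} {v} {ℓ} v′ v′↦v leaf vw∈E =
  trans (countList-removeVertex w (λ e → incident e v) (λ e → incident e v′)
                                  (λ s t c w≢s w≢t → cong₂ _∨_ (renumber s w≢s) (renumber t w≢t)) E)
        (cong (λ z → degree (removeVertex w E) v′ + z)
              (trans (countList-∧-unique (λ e → incident e w) (incident-tgt w (v ⟶ w ∶ ℓ) refl)
                                         (λ e → incident e v) E leaf vw∈E)
                     (cong (λ b → ind (b ∨ does (w ≟ v))) (dec-true (v ≟ v) refl))))
  where
  renumber : ∀ s (w≢s : w ≢ s) → does (s ≟ v) ≡ does (punchOut w≢s ≟ v′)
  renumber s w≢s = ≡-ext-Bool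
    (λ s≟v → dec-true (punchOut w≢s ≟ v′)
               (trans (FinP.punchOut-cong w (trans (does-≟⇒≡ s≟v) (sym v′↦v))) (FinP.punchOut-punchIn w)))
    (λ s≟v′ → dec-true (s ≟ v)
               (trans (sym (FinP.punchIn-punchOut w≢s)) (trans (cong (punchIn w) (does-≟⇒≡ s≟v′)) v′↦v)))

extend : ∀ {k N} → Fin (suc k) → (Fin k → Fin N) → Fin N → Fin (suc k) → Fin N
extend w φ y j with w ≟ j
... | yes _   = y
... | no w≢j = φ (punchOut w≢j)

extend-≢ : ∀ {k N} w (φ : Fin k → Fin N) y {j} (w≢j : w ≢ j) → extend w φ y j ≡ φ (punchOut w≢j)
extend-≢ w φ y {j} w≢j with w ≟ j
... | yes w≡j = ⊥-elim (w≢j w≡j)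
... | no _    = cong φ (FinP.punchOut-cong w refl)

extend-at : ∀ {k N} w (φ : Fin k → Fin N) y → extend w φ y w ≡ y
extend-at w φ y with w ≟ w
... | yes _   = refl
... | no w≢w = ⊥-elim (w≢w refl)

extend-punchIn : ∀ {k N} w (φ : Fin k → Fin N) y u → extend w φ y (punchIn w u) ≡ φ u
extend-punchIn w φ y u =
  trans (extend-≢ w φ y (FinP.punchInᵢ≢i w u ∘′ sym)) (cong φ (FinP.punchOut-punchIn w))

∈Image : ∀ {N k} (φ : Fin k → Fin N) u → Image φ (φ u) ≡ true
∈Image φ u = ∃⇒anyFin u (dec-true (φ u ≟ φ u) refl)

Image⇒∃ : ∀ {N k} (φ : Fin k → Fin N) y → Image φ y ≡ true → ∃ λ u → φ u ≡ y
Image⇒∃ φ y h = let u , φu≟y = anyFin⇒∃ h in u , does-≟⇒≡ φu≟y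

InSet⇒Image : ∀ {N n k} (E : List (Edge k n)) (φ : Fin k → Fin N) x i →
              InSet E φ x i ≡ true → Image φ x ≡ true
InSet⇒Image E φ x i h =
  let e , _ , hit = anyList⇒∃ E h
  in subst (λ z → Image φ z ≡ true) (does-≟⇒≡ (proj₂ (∧≡true {does (colour e ≟ i)} hit)))
           (∈Image φ (tgt e))

module LeafExtension {N n k : ℕ} (E : List (Edge (suc k) n)) (w v : Fin (suc k)) (ℓ : Fin n)
  (v′ : Fin k) (v′↦v : punchIn w v′ ≡ v) (leaf : degree E w ≡ 1) (vw∈E : (v ⟶ w ∶ ℓ) ∈ E)
  (φ : Fin k → Fin N) (y : Fin N) (y∉φ : Image φ y ≡ false) where

  ψ : Fin (suc k) → Fin N
  ψ = extend w φ y

  K : List (Edge k n)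
  K = removeVertex w E

  ψv≡φv′ : ψ v ≡ φ v′
  ψv≡φv′ = trans (cong ψ (sym v′↦v)) (extend-punchIn w φ y v′)

  vw-incident : incident (v ⟶ w ∶ ℓ) w ≡ true
  vw-incident = incident-tgt w (v ⟶ w ∶ ℓ) refl

  y≢φ : ∀ u → y ≢ φ u
  y≢φ u y≡φu =
    false≢true (trans (sym y∉φ) (subst (λ z → Image φ z ≡ true) (sym y≡φu) (∈Image φ u)))

  dcol-extend : ∀ i x →
    dcol E ψ i x ≡ dcol K φ i x + ind (does (ℓ ≟ i) ∧ (does (φ v′ ≟ x) ∨ does (y ≟ x)))
  dcol-extend i x =
    trans (countList-removeVertex w q q′ restricts E)
          (cong (λ z → dcol K φ i x + z)
                (trans (countList-∧-unique (λ e → incident e w) vw-incident q E leaf vw∈E)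
                       (cong₂ (λ a b → ind (does (ℓ ≟ i) ∧ (does (a ≟ x) ∨ does (b ≟ x))))
                              ψv≡φv′ (extend-at w φ y))))
    where
    q : Edge (suc k) n → Bool
    q e = does (colour e ≟ i) ∧ (does (ψ (src e) ≟ x) ∨ does (ψ (tgt e) ≟ x))
    q′ : Edge k n → Bool
    q′ e = does (colour e ≟ i) ∧ (does (φ (src e) ≟ x) ∨ does (φ (tgt e) ≟ x))
    restricts : Restricts w q q′
    restricts s t c w≢s w≢t =
      cong₂ (λ a b → does (c ≟ i) ∧ (does (a ≟ x) ∨ does (b ≟ x)))
            (extend-≢ w φ y w≢s) (extend-≢ w φ y w≢t)

  InSet-extend : ∀ x i → InSet E ψ x i ≡ InSet K φ x i ∨ (does (ℓ ≟ i) ∧ does (y ≟ x))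
  InSet-extend x i =
    trans (anyList-removeVertex w q q′ restricts E)
          (cong (λ b → InSet K φ x i ∨ b)
                (trans (anyList-∧-unique (λ e → incident e w) vw-incident q E leaf vw∈E)
                       (cong (λ b → does (ℓ ≟ i) ∧ does (b ≟ x)) (extend-at w φ y))))
    where
    q : Edge (suc k) n → Bool
    q e = does (colour e ≟ i) ∧ does (ψ (tgt e) ≟ x)
    q′ : Edge k n → Bool
    q′ e = does (colour e ≟ i) ∧ does (φ (tgt e) ≟ x)
    restricts : Restricts w q q′
    restricts s t c w≢s w≢t = cong (λ b → does (c ≟ i) ∧ does (b ≟ x)) (extend-≢ w φ y w≢t)

  Image-extend : ∀ z → Image ψ z ≡ Image φ z ∨ does (y ≟ z)
  Image-extend z = ≡-ext-Bool to from
    where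
    hit : ∀ j → ψ j ≡ z → Dec (w ≡ j) → Image φ z ∨ does (y ≟ z) ≡ true
    hit j ψj≡z (yes w≡j)
      rewrite dec-true (y ≟ z) (trans (sym (extend-at w φ y)) (trans (cong ψ w≡j) ψj≡z)) = BoolP.∨-zeroʳ _
    hit j ψj≡z (no w≢j)
      rewrite subst (λ z → Image φ z ≡ true) (trans (sym (extend-≢ w φ y w≢j)) ψj≡z)
                    (∈Image φ (punchOut w≢j)) = refl
    to : Image ψ z ≡ true → Image φ z ∨ does (y ≟ z) ≡ true
    to h = let j , ψj≡z = Image⇒∃ ψ z h in hit j ψj≡z (w ≟ j)
    from : Image φ z ∨ does (y ≟ z) ≡ true → Image ψ z ≡ true
    from h with ∨≡true {Image φ z} h
    ... | inj₁ z∈φ = let u , φu≡z = Image⇒∃ φ z z∈φ in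
      ∃⇒anyFin {p = λ j → does (ψ j ≟ z)} (punchIn w u)
               (dec-true (ψ (punchIn w u) ≟ z) (trans (extend-punchIn w φ y u) φu≡z))
    ... | inj₂ y≟z =
      ∃⇒anyFin {p = λ j → does (ψ j ≟ z)} w
               (dec-true (ψ w ≟ z) (trans (extend-at w φ y) (does-≟⇒≡ y≟z)))

  cost-extend : ∀ D x i → cost E ψ D x i ≡ cost K φ D x i ℤ.- χ (⁅ φ v′ , ℓ ⁆ x i)
  cost-extend D x i =
    trans (cong₂ (λ a b → χ a ℤ.+ (+ D ℤ.- + b)) (InSet-extend x i) (dcol-extend i x))
          (shift (InSet K φ x i) (dcol K φ i x) (does (ℓ ≟ i)) (does (φ v′ ≟ x)) (does (y ≟ x))
                 y≟x⇒φv′≢x y≟x⇒∉InSet)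
    where
    y≟x⇒φv′≢x : does (y ≟ x) ≡ true → does (φ v′ ≟ x) ≡ false
    y≟x⇒φv′≢x y≟x =
      dec-false (φ v′ ≟ x) (λ φv′≡x → y≢φ v′ (trans (does-≟⇒≡ y≟x) (sym φv′≡x)))
    y≟x⇒∉InSet : does (y ≟ x) ≡ true → InSet K φ x i ≡ false
    y≟x⇒∉InSet y≟x = BoolP.¬-not λ x∈ → false≢true
      (trans (sym y∉φ) (subst (λ z → Image φ z ≡ true) (sym (does-≟⇒≡ y≟x)) (InSet⇒Image K φ x i x∈)))
    elsewhere : ∀ j → j ≡ j ℤ.- + 0
    elsewhere = solve-∀
    at-φv′ : ∀ j D d → j ℤ.+ (D ℤ.- (d ℤ.+ + 1)) ≡ (j ℤ.+ (D ℤ.- d)) ℤ.- + 1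
    at-φv′ = solve-∀
    at-y : ∀ D d → + 1 ℤ.+ (D ℤ.- (d ℤ.+ + 1)) ≡ (+ 0 ℤ.+ (D ℤ.- d)) ℤ.- + 0
    at-y = solve-∀
    -- a: the colour is ℓ;  b: x = φ v′;  c: x = y
    shift : ∀ I d a b c → (c ≡ true → b ≡ false) → (c ≡ true → I ≡ false) →
            χ (I ∨ (a ∧ c)) ℤ.+ (+ D ℤ.- + (d + ind (a ∧ (b ∨ c))))
              ≡ (χ I ℤ.+ (+ D ℤ.- + d)) ℤ.- χ (b ∧ a)
    shift I d false b c _ _ rewrite BoolP.∨-identityʳ I | ℕP.+-identityʳ d | BoolP.∧-zeroʳ b = elsewhere _
    shift I d true  true  true  b≢ _ = ⊥-elim (false≢true (sym (b≢ refl)))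
    shift I d true  true  false _ _ rewrite BoolP.∨-identityʳ I | ℤP.pos-+ d 1 = at-φv′ (χ I) (+ D) (+ d)
    shift I d true  false true  _ I≢ rewrite I≢ refl | ℤP.pos-+ d 1 = at-y (+ D) (+ d)
    shift I d true  false false _ _ rewrite BoolP.∨-identityʳ I | ℕP.+-identityʳ d = elsewhere _

  weight-extend : ∀ D S → weight S (cost E ψ D) ≡ weight S (cost K φ D) ℤ.- χ (S (φ v′) ℓ)
  weight-extend D S = begin
    weight S (cost E ψ D)
      ≡⟨ Σ²-cong (λ x i → trans (cong (λ z → if S x i then z else + 0) (cost-extend D x i))
                                (split (S x i) (does (φ v′ ≟ x)) (does (ℓ ≟ i)) (cost K φ D x i))) ⟩
    Σ² (λ x i → (if S x i then cost K φ D x i else + 0) ℤ.- at-φv′ℓ x i)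
      ≡⟨ Σ²-- (λ x i → if S x i then cost K φ D x i else + 0) at-φv′ℓ ⟩
    weight S (cost K φ D) ℤ.- Σ² at-φv′ℓ
      ≡⟨ cong (λ z → weight S (cost K φ D) ℤ.- z) (Σ²-point (φ v′) ℓ (λ x i → χ (S x i))) ⟩
    weight S (cost K φ D) ℤ.- χ (S (φ v′) ℓ) ∎
    where
    open ≡-Reasoning
    at-φv′ℓ : Fin N → Fin n → ℤ
    at-φv′ℓ x i = if does (φ v′ ≟ x) then (if does (ℓ ≟ i) then χ (S x i) else + 0) else + 0
    split : ∀ s a b c → (if s then c ℤ.- χ (a ∧ b) else + 0)
                      ≡ (if s then c else + 0) ℤ.- (if a then (if b then χ s else + 0) else + 0)
    split true  true  true  c = refl
    split true  true  false c = refl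
    split true  false b     c = refl
    split false true  true  c = refl
    split false true  false c = refl
    split false false b     c = refl

  outside-extend : ∀ (Gs : Fin n → Graph N) S →
                   outside Gs (Image ψ) S ℤ.+ χ (Nbhd Gs S y) ≡ outside Gs (Image φ) S
  outside-extend Gs S = begin
    outside Gs (Image ψ) S ℤ.+ χ (Nbhd Gs S y)
      ≡⟨ cong (λ z → outside Gs (Image ψ) S ℤ.+ z) (sumFinℤ-point y (λ z → χ (Nbhd Gs S z))) ⟨
    outside Gs (Image ψ) S ℤ.+ sumFinℤ at-y
      ≡⟨ sumFinℤ-+ (λ z → χ (Nbhd Gs S z ∧ not (Image ψ z))) at-y ⟨
    sumFinℤ (λ z → χ (Nbhd Gs S z ∧ not (Image ψ z)) ℤ.+ at-y z)
      ≡⟨ sumFinℤ-cong (λ z → trans (cong (λ b → χ (Nbhd Gs S z ∧ not b) ℤ.+ at-y z) (Image-extend z))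
                                   (pointwise (Nbhd Gs S z) (Image φ z) (does (y ≟ z)) (y≟z⇒∉φ z))) ⟩
    outside Gs (Image φ) S ∎
    where
    open ≡-Reasoning
    at-y : Fin N → ℤ
    at-y z = if does (y ≟ z) then χ (Nbhd Gs S z) else + 0
    y≟z⇒∉φ : ∀ z → does (y ≟ z) ≡ true → Image φ z ≡ false
    y≟z⇒∉φ z y≟z = subst (λ z → Image φ z ≡ false) (does-≟⇒≡ y≟z) y∉φ
    pointwise : ∀ a I c → (c ≡ true → I ≡ false) →
                χ (a ∧ not (I ∨ c)) ℤ.+ (if c then χ a else + 0) ≡ χ (a ∧ not I)
    pointwise false I     true  _ = refl
    pointwise false I     false _ = refl
    pointwise true  I     true  I≢ rewrite I≢ refl = refl
    pointwise true  true  false _ = refl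
    pointwise true  false false _ = refl

  violation⇒tight : ∀ (Gs : Fin n → Graph N) m D A → WeightBound Gs K φ m D A →
    ∃ (Violation Gs E ψ m D A) →
    ∃ λ S → (S ⊆ᶜ A × size S ≤ m × outside Gs (Image φ) S ℤ.≤ weight S (cost K φ D))
            × Nbhd Gs S y ≡ true × S (φ v′) ℓ ≡ false
  violation⇒tight Gs m D A bound (S , S⊆A , |S|≤m , ¬bound)
    with shifted-violation (S (φ v′) ℓ) (Nbhd Gs S y) _ _ (bound S S⊆A |S|≤m) ¬shifted-bound
    where
    ¬shifted-bound : ¬ (weight S (cost K φ D) ℤ.- χ (S (φ v′) ℓ)
                        ℤ.≤ outside Gs (Image φ) S ℤ.- χ (Nbhd Gs S y))
    ¬shifted-bound le =
      ¬bound (subst₂ ℤ._≤_ (sym (weight-extend D S)) (sym (+≡⇒≡- (outside-extend Gs S))) le)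
  ... | S∌ , y∈NS , tight = S , (S⊆A , |S|≤m , tight) , y∈NS , S∌

  extend-injective : Injective _≡_ _≡_ φ → Injective _≡_ _≡_ ψ
  extend-injective φ-inj {a} {b} ψa≡ψb = cases (w ≟ a) (w ≟ b)
    where
    cases : Dec (w ≡ a) → Dec (w ≡ b) → a ≡ b
    cases (yes w≡a) (yes w≡b) = trans (sym w≡a) w≡b
    cases (yes w≡a) (no w≢b)  = ⊥-elim (y≢φ _ (trans (sym (extend-at w φ y))
                                  (trans (cong ψ w≡a) (trans ψa≡ψb (extend-≢ w φ y w≢b)))))
    cases (no w≢a)  (yes w≡b) = ⊥-elim (y≢φ _ (trans (sym (extend-at w φ y))
                                  (trans (cong ψ w≡b) (trans (sym ψa≡ψb) (extend-≢ w φ y w≢a)))))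
    cases (no w≢a)  (no w≢b)  = FinP.punchOut-injective w≢a w≢b
      (φ-inj (trans (sym (extend-≢ w φ y w≢a)) (trans ψa≡ψb (extend-≢ w φ y w≢b))))

  extend-edges : ∀ (Gs : Fin n → Graph N) → Gs ℓ (φ v′) y ≡ true →
    (∀ e → e ∈ K → Gs (colour e) (φ (src e)) (φ (tgt e)) ≡ true) →
    ∀ e → e ∈ E → Gs (colour e) (ψ (src e)) (ψ (tgt e)) ≡ true
  extend-edges Gs φv′y φ-edges e e∈E = cases (w ≟ src e) (w ≟ tgt e)
    where
    the-leaf-edge : incident e w ≡ true → Gs (colour e) (ψ (src e)) (ψ (tgt e)) ≡ true
    the-leaf-edge inc =
      subst (λ e → Gs (colour e) (ψ (src e)) (ψ (tgt e)) ≡ true)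
            (sym (countList≡1⇒≡ (λ e → incident e w) vw-incident E leaf vw∈E e∈E inc))
            (subst₂ (λ a b → Gs ℓ a b ≡ true) (sym ψv≡φv′) (sym (extend-at w φ y)) φv′y)
    cases : Dec (w ≡ src e) → Dec (w ≡ tgt e) → Gs (colour e) (ψ (src e)) (ψ (tgt e)) ≡ true
    cases (yes w≡s) _         = the-leaf-edge (incident-src w e w≡s)
    cases (no _)    (yes w≡t) = the-leaf-edge (incident-tgt w e w≡t)
    cases (no w≢s)  (no w≢t)  =
      subst₂ (λ a b → Gs (colour e) a b ≡ true) (sym (extend-≢ w φ y w≢s)) (sym (extend-≢ w φ y w≢t))
             (φ-edges _ (∈-removeVertex w E e∈E w≢s w≢t))

dcol≤degree : ∀ {N n k} (E : List (Edge k n)) {φ : Fin k → Fin N} → Injective _≡_ _≡_ φ →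
              ∀ i u → dcol E φ i (φ u) ≤ degree E u
dcol≤degree E {φ} φ-inj i u =
  countList-mono (λ e h → incident-u e (∨≡true (proj₂ (∧≡true {does (colour e ≟ i)} h)))) E
  where
  incident-u : ∀ e → does (φ (src e) ≟ φ u) ≡ true ⊎ does (φ (tgt e) ≟ φ u) ≡ true →
               incident e u ≡ true
  incident-u e (inj₁ h) rewrite dec-true (src e ≟ u) (φ-inj (does-≟⇒≡ h)) = refl
  incident-u e (inj₂ h) rewrite dec-true (tgt e ≟ u) (φ-inj (does-≟⇒≡ h)) = BoolP.∨-zeroʳ _

cost≤1+D : ∀ {N n k} (E : List (Edge k n)) (φ : Fin k → Fin N) D x i → cost E φ D x i ℤ.≤ + (D + 1)
cost≤1+D E φ D x i =
  ℤP.≤-trans (ℤP.+-mono-≤ (χ-≤1 (InSet E φ x i)) (ℤP.i-j≤i (+ D) (+ dcol E φ i x)))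
             (ℤP.≤-reflexive (trans (sym (ℤP.pos-+ 1 D)) (cong +_ (ℕP.+-comm 1 D))))

cost-positive : ∀ {N n k} (E : List (Edge k n)) (φ : Fin k → Fin N) D x i →
                dcol E φ i x + 1 ≤ D → + 1 ℤ.≤ cost E φ D x i
cost-positive E φ D x i d<D =
  ℤP.≤-trans (subst₂ ℤ._≤_ (cancel (+ d) (+ 1)) (sym (ℤP.+-identityˡ (+ D ℤ.- + d)))
                           (ℤP.+-monoˡ-≤ (- + d) (subst (ℤ._≤ + D) (ℤP.pos-+ d 1) (+≤+ d<D))))
             (ℤP.+-monoˡ-≤ (+ D ℤ.- + d) (χ-nonneg (InSet E φ x i)))
  where
  d = dcol E φ i x
  cancel : ∀ a b → (a ℤ.+ b) ℤ.- a ≡ b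
  cancel = solve-∀

module TightSets {N n k : ℕ} (Gs : Fin n → Graph N) (A : ColorSet N n) (m D : ℕ)
  (0<m : 0 < m) (expander : IsColorExpander Gs (2 * m) (2 * D + 1) A) (k<mD : suc k ≤ m * D)
  (φ : Fin k → Fin N) (c : Fin N → Fin n → ℤ) (c≤1+D : ∀ x i → c x i ℤ.≤ + (D + 1))
  (bound : ∀ S → S ⊆ᶜ A → size S ≤ m → weight S c ℤ.≤ outside Gs (Image φ) S) where

  out : ColorSet N n → ℤ
  out = outside Gs (Image φ)

  Tight : ColorSet N n → Set
  Tight S = S ⊆ᶜ A × size S ≤ m × out S ℤ.≤ weight S c

  SmallTight : ColorSet N n → Set
  SmallTight S = S ⊆ᶜ A × size S < m × out S ℤ.≤ weight S c

  -- Expansion gives |N(X)| ≥ (2D+1)|X|, while tightness gives |N(X)| ≤ |φ(K)| + (D+1)|X|.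
  tight⇒small : ∀ X → X ⊆ᶜ A → size X ≤ 2 * m → out X ℤ.≤ weight X c → size X < m
  tight⇒small X X⊆A |X|≤2m tight = ℕP.≰⇒> λ m≤s →
    ℕP.<⇒≱ k<mD (ℕP.≤-trans (ℕP.≤-reflexive (ℕP.*-comm m D))
                            (ℕP.≤-trans (ℕP.*-monoʳ-≤ D m≤s) Ds≤k))
    where
    s = size X
    expansion : + ((2 * D + 1) * s) ℤ.≤ + ((D + 1) * s + k)
    expansion = begin
      + ((2 * D + 1) * s)             ≤⟨ +≤+ (expander X X⊆A |X|≤2m) ⟩
      + count (Nbhd Gs X)             ≡⟨ count≡card (Nbhd Gs X) ⟩
      card (Nbhd Gs X)                ≤⟨ card-∖ (Nbhd Gs X) (Image φ) ⟩
      out X ℤ.+ card (Image φ)        ≤⟨ ℤP.+-mono-≤ tight (card-Image φ) ⟩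
      weight X c ℤ.+ + k              ≤⟨ ℤP.+-monoˡ-≤ (+ k) (weight-mono-≤ X c≤1+D) ⟩
      weight X (λ _ _ → + (D + 1)) ℤ.+ + k ≡⟨ cong (ℤ._+ + k) (weight-const X (+ (D + 1))) ⟩
      + (D + 1) ℤ.* + s ℤ.+ + k       ≡⟨ cong (ℤ._+ + k) (ℤP.pos-* (D + 1) s) ⟨
      + ((D + 1) * s) ℤ.+ + k         ≡⟨ ℤP.pos-+ ((D + 1) * s) k ⟨
      + ((D + 1) * s + k)             ∎
      where open ℤP.≤-Reasoning
    Ds≤k : D * s ≤ k
    Ds≤k = ℕP.+-cancelʳ-≤ ((D + 1) * s) (D * s) k
      (subst₂ _≤_ (split D s) (ℕP.+-comm _ k) (ℤP.drop‿+≤+ expansion))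
      where
      split : ∀ D s → (2 * D + 1) * s ≡ D * s + (D + 1) * s
      split = ℕSolver.solve-∀

  ∅-smallTight : SmallTight ∅
  ∅-smallTight =
    (λ _ _ ()) , subst (_< m) (sym (size-∅ {N} {n})) 0<m ,
    ℤP.≤-reflexive (trans (outside-∅ Gs (Image φ)) (sym (Σ²-zero {N} {n})))

  ∪-smallTight : ∀ U S → SmallTight U → Tight S → SmallTight (U ∪ S)
  ∪-smallTight U S (U⊆A , |U|<m , U-tight) (S⊆A , |S|≤m , S-tight) =
    ∪⊆A , tight⇒small (U ∪ S) ∪⊆A |U∪S|≤2m ∪-tight , ∪-tight
    where
    ∪⊆A : (U ∪ S) ⊆ᶜ A
    ∪⊆A x i h with ∨≡true {U x i} h
    ... | inj₁ Uxi = U⊆A x i Uxi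
    ... | inj₂ Sxi = S⊆A x i Sxi
    |U∪S|≤2m : size (U ∪ S) ≤ 2 * m
    |U∪S|≤2m = ℕP.≤-trans (size-∪ U S)
                 (subst (size U + size S ≤_) (cong (λ z → m + z) (sym (ℕP.+-identityʳ m)))
                        (ℕP.+-mono-≤ (ℕP.<⇒≤ |U|<m) |S|≤m))
    ∩-bound : weight (U ∩ S) c ℤ.≤ out (U ∩ S)
    ∩-bound = bound (U ∩ S) (λ x i h → U⊆A x i (proj₁ (∧≡true h)))
                    (ℕP.≤-trans (size-mono (λ x i h → proj₁ (∧≡true {U x i} h))) (ℕP.<⇒≤ |U|<m))
    ∪-tight : out (U ∪ S) ℤ.≤ weight (U ∪ S) c
    ∪-tight = +-cancelʳ-≤ (out (U ∪ S)) (weight (U ∪ S) c) (out (U ∩ S)) (begin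
      out (U ∪ S) ℤ.+ out (U ∩ S)       ≤⟨ outside-submodular Gs (Image φ) U S ⟩
      out U ℤ.+ out S                   ≤⟨ ℤP.+-mono-≤ U-tight S-tight ⟩
      weight U c ℤ.+ weight S c         ≡⟨ weight-∪-∩ U S c ⟨
      weight (U ∪ S) c ℤ.+ weight (U ∩ S) c ≤⟨ ℤP.+-monoʳ-≤ (weight (U ∪ S) c) ∩-bound ⟩
      weight (U ∪ S) c ℤ.+ out (U ∩ S)  ∎)
      where open ℤP.≤-Reasoning

  module _ (p : Fin N) (ℓ : Fin n) where

    Candidate : Fin N → Set
    Candidate y = Gs ℓ p y ≡ true × Image φ y ≡ false

    candidate? : ∀ y → Dec (Candidate y)
    candidate? y = (Gs ℓ p y Bool.≟ true) ×-dec (Image φ y Bool.≟ false)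

    CoveredByTight : Fin N → Set
    CoveredByTight y = ∃ λ S → Tight S × Nbhd Gs S y ≡ true × S p ℓ ≡ false

    cover : (∀ y → Candidate y → CoveredByTight y) → ∀ L →
            ∃ λ U → SmallTight U × U p ℓ ≡ false ×
                    (∀ y → y ∈ L → Candidate y → Nbhd Gs U y ≡ true)
    cover covered [] = ∅ , ∅-smallTight , refl , λ _ ()
    cover covered (y ∷ L) with cover covered L | candidate? y
    ... | U , U-smallTight , U∌ , U-covers | no ¬cand =
      U , U-smallTight , U∌ ,
      λ { z (here refl) cand → ⊥-elim (¬cand cand) ; z (there z∈L) → U-covers z z∈L }
    ... | U , U-smallTight , U∌ , U-covers | yes cand =
      let S , S-tight , y∈NS , S∌ = covered y cand in
      U ∪ S , ∪-smallTight U S U-smallTight S-tight , cong₂ _∨_ U∌ S∌ ,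
      λ { z (here refl) _ → Nbhd-mono Gs (λ x i Sxi → trans (cong (U x i ∨_) Sxi) (BoolP.∨-zeroʳ _)) z y∈NS
        ; z (there z∈L) cand′ → Nbhd-mono Gs (λ x i Uxi → cong (_∨ S x i) Uxi) z (U-covers z z∈L cand′) }

    -- Adding (p, ℓ) to the union U of all the tight sets does not enlarge N(U) ∖ φ(K).
    not-all-covered : A p ℓ ≡ true → + 1 ℤ.≤ c p ℓ → ¬ (∀ y → Candidate y → CoveredByTight y)
    not-all-covered A∋pℓ 1≤c covered with cover covered (allFin N)
    ... | U , (U⊆A , |U|<m , U-tight) , U∌ , U-covers =
      ℤP.<⇒≱ (ℤP.<-≤-trans (ℤ.+<+ (s≤s z≤n)) 1≤c) c≤0
      where
      T = U ∪ ⁅ p , ℓ ⁆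
      T⊆A : T ⊆ᶜ A
      T⊆A x i h with ∨≡true {U x i} h
      ... | inj₁ Uxi = U⊆A x i Uxi
      ... | inj₂ xi≡pℓ = let x≡p , i≡ℓ = ∧≡true {does (p ≟ x)} xi≡pℓ in
        subst₂ (λ a j → A a j ≡ true) (does-≟⇒≡ x≡p) (does-≟⇒≡ i≡ℓ) A∋pℓ
      |T|≤m : size T ≤ m
      |T|≤m = subst (_≤ m) (trans (ℕP.+-comm 1 (size U)) (sym (size-∪-point U p ℓ U∌))) |U|<m
      N[T]⊆N[U] : ∀ y → Nbhd Gs T y ≡ true → Image φ y ≡ false → Nbhd Gs U y ≡ true
      N[T]⊆N[U] y y∈NT y∉φ with ∨≡true {Nbhd Gs U y} (Nbhd-∪ Gs U ⁅ p , ℓ ⁆ y y∈NT)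
      ... | inj₁ y∈NU = y∈NU
      ... | inj₂ y∈Np = U-covers y (∈-allFin y) (Nbhd-point Gs p ℓ y y∈Np , y∉φ)
      out-T≤out-U : out T ℤ.≤ out U
      out-T≤out-U = card-mono λ y h → let y∈NT , y∉φ = ∧≡true {Nbhd Gs T y} h in
        cong₂ _∧_ (N[T]⊆N[U] y y∈NT (trans (sym (BoolP.not-involutive _)) (cong not y∉φ))) y∉φ
      c≤0 : c p ℓ ℤ.≤ + 0
      c≤0 = +-cancelˡ-≤ (weight U c) (c p ℓ) (+ 0) (begin
        weight U c ℤ.+ c p ℓ   ≡⟨ weight-∪-point U p ℓ c U∌ ⟨
        weight T c             ≤⟨ bound T T⊆A |T|≤m ⟩
        out T                  ≤⟨ out-T≤out-U ⟩
        out U                  ≤⟨ U-tight ⟩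
        weight U c             ≡⟨ ℤP.+-identityʳ (weight U c) ⟨
        weight U c ℤ.+ + 0     ∎)
        where open ℤP.≤-Reasoning

IsForest⇒loopless : ∀ {k n} (E : List (Edge k n)) → IsForest E →
                    ∀ {v w ℓ} → (v ⟶ w ∶ ℓ) ∈ E → w ≢ v
IsForest⇒loopless E forest {v} e∈E refl = forest record
  { r        = 0
  ; edge     = λ _ → index e∈E
  ; vert     = λ _ → v
  ; edge-inj = λ { {zero} {zero} _ → refl }
  ; vert-inj = λ { {zero} {zero} _ → refl }
  ; joins    = λ { zero → inj₁ (cong src (sym (lookup-index e∈E)) , cong tgt (sym (lookup-index e∈E))) }
  }

lemma2p2 : ∀ {N n : ℕ} (Gs : Fin n → Graph N) → (∀ i → IsSimpleGraph (Gs i))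
    → (A : ColorSet N n) (m D : ℕ) → 0 < m → 0 < D
    → {k : ℕ} (E : List (Edge (suc k) n)) → IsForest E
    → suc k ≤ m * D → (∀ u → degree E u ≤ D)
    → (v w : Fin (suc k)) (ℓ : Fin n) → degree E w ≡ 1 → (v ⟶ w ∶ ℓ) ∈ E
    → IsColorExpander Gs (2 * m) (2 * D + 1) A
    → (φ : Fin k → Fin N) → GoodEmbedding Gs (removeVertex w E) φ m D A
    → (∀ u → punchIn w u ≡ v → A (φ u) ℓ ≡ true)
    → ∃ λ (ψ : Fin (suc k) → Fin N) → GoodEmbedding Gs E ψ m D A × (∀ u → ψ (punchIn w u) ≡ φ u)
lemma2p2 Gs _ A m D 0<m _ E forest k<mD deg≤D v w ℓ leaf vw∈E expander φ
         ((φ-inj , φ-edges) , φ-good) A∋φv =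
  extension (FinP.any? λ y → candidate? (φ v′) ℓ y ×-dec ¬? (violation? Gs E (extend w φ y) m D A))
  where
  w≢v = IsForest⇒loopless E forest vw∈E
  v′ = punchOut w≢v
  v′↦v = FinP.punchIn-punchOut w≢v
  K = removeVertex w E
  K-bound = IsGood⇒WeightBound Gs K φ m D A φ-good
  open TightSets Gs A m D 0<m expander k<mD φ (cost K φ D) (cost≤1+D K φ D) K-bound
  Extendable : Fin _ → Set
  Extendable y = Candidate (φ v′) ℓ y × ¬ ∃ (Violation Gs E (extend w φ y) m D A)
  1≤cost : + 1 ℤ.≤ cost K φ D (φ v′) ℓ
  1≤cost = cost-positive K φ D (φ v′) ℓ (ℕP.≤-trans (ℕP.+-monoˡ-≤ 1 (dcol≤degree K φ-inj ℓ v′))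
                                          (subst (_≤ D) (degree-removeLeaf E v′ v′↦v leaf vw∈E) (deg≤D v)))
  extension : Dec (∃ Extendable) →
              ∃ λ ψ → GoodEmbedding Gs E ψ m D A × (∀ u → ψ (punchIn w u) ≡ φ u)
  extension (yes (y , (φv′y , y∉φ) , ¬violation)) =
    ψ , ((extend-injective φ-inj , extend-edges Gs φv′y φ-edges) ,
         WeightBound⇒IsGood Gs E ψ m D A (¬Violation⇒WeightBound Gs E ψ m D A ¬violation)) ,
    extend-punchIn w φ y
    where open LeafExtension E w v ℓ v′ v′↦v leaf vw∈E φ y y∉φ
  extension (no ¬extendable) = ⊥-elim (not-all-covered (φ v′) ℓ (A∋φv v′ v′↦v) 1≤cost covered)
    where
    covered : ∀ y → Candidate (φ v′) ℓ y → CoveredByTight (φ v′) ℓ y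
    covered y (φv′y , y∉φ) with violation? Gs E (extend w φ y) m D A
    ... | yes violation =
      LeafExtension.violation⇒tight E w v ℓ v′ v′↦v leaf vw∈E φ y y∉φ Gs m D A K-bound violation
    ... | no ¬violation = ⊥-elim (¬extendable (y , (φv′y , y∉φ) , ¬violation))
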